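{- Let $k=k(n)$ and $w=w(n)$ be integers with $2kw\left(2w + \lceil \log k \rceil + \lceil \log 2w \rceil\right)<n$. Then $N(SAF_{k,w})\geq w^{(k-1)(w-2)}$.
   Context: Logarithms are base 2. Definition of $SAF_{k,w}:\{0,1\}^n\to\{0,1\}$: the input variables are divided into $2kw$ blocks numbered $p=0,\dots,2kw-1$, each of $a=\lceil n/(2kw)\rceil$ variables; in block $p$ the first $\lceil\log k\rceil + \lceil\log 2w\rceil$ variables $y^p_0,y^p_1,\dots$ are address variables and the remaining $b=a-(\lceil\log k\rceil + \lceil\log 2w\rceil)$ variables $x^p_0,\dots,x^p_{b-1}$ are value variables. For an input $X$ define $AdrK(X,p)=\sum_{j=0}^{\lceil\log k\rceil-1}y^{p}_{j}2^{j} \bmod k$ and $AdrW(X,p)=\sum_{j=0}^{\lceil\log 2w\rceil-1}y^{p}_{j+\lceil\log k\rceil}2^{j} \bmod 2w$. For $i\in\{0,\dots,2w-1\}$, $t\in\{0,\dots,k-1\}$, let $Ind(X,i,t)$ be the minimal $p$ with $AdrK(X,p)=t$ and $AdrW(X,p)=i$, or $-1$ if there is no such $p$. Let $Val(X,i,t)=\sum_{j=0}^{b-1}x^{p}_{j} \bmod w$ where $p=Ind(X,i,t)$ if $p\ge 0$, and $Val(X,i,t)=-1$ if $Ind(X,i,t)<0$. Define $Step_1(X,-1)=Step_2(X,-1)=0$ and for $t=0,\dots,k-1$: $Step_1(X,t)=-1$ if $Step_2(X,t-1)=-1$, otherwise $Step_1(X,t)=Val(X,Step_2(X,t-1),t)+w$;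 $Step_2(X,t)=-1$ if $Step_1(X,t)=-1$, otherwise $Step_2(X,t)=Val(X,Step_1(X,t),t)$. Finally $SAF_{k,w}(X)=0$ if $Step_2(X,k-1)\le 0$ and $SAF_{k,w}(X)=1$ otherwise. Definition of $N(f)$: for a partition $\pi=(X_A,X_B)$ of the variable set $X$, $N^\pi(f)$ is the number of distinct subfunctions $f|_\rho$ of $f$ obtained by fixing the variables of $X_A$ by an assignment $\rho\in\{0,1\}^{|X_A|}$. For a permutation $\theta=(j_1,\dots,j_n)$ of $\{1,\dots,n\}$, $\Pi(\theta)$ is the set of partitions $(\{x_{j_1},\dots,x_{j_u}\},\{x_{j_{u+1}},\dots,x_{j_n}\})$ with $1<u<n$. Then $N^\theta(f)=\max_{\pi\in\Pi(\theta)}N^\pi(f)$ and $N(f)=\min_{\theta}N^\theta(f)$, the minimum over all permutations $\theta$ of $\{1,\dots,n\}$. -}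

module Defs where

open import Data.Bool using (Bool; true; false; if_then_else_)
import Data.Bool.Properties as BoolP
open import Data.Nat using (ℕ; zero; suc; _+_; _*_; _∸_; _^_; _⊔_; _<?_; _/_; _%_)
open import Data.Nat.Logarithm using (⌈log₂_⌉)
open import Data.Fin using (Fin; toℕ; fromℕ<)
open import Data.Fin.Permutation using (Permutation′; _⟨$⟩ˡ_)
open import Data.List using (List; []; _∷_; map; foldr; length; upTo; deduplicate; concatMap; _++_)
open import Data.List.Properties using (≡-dec)
open import Data.Maybe using (Maybe; just; nothing)
open import Relation.Nullary using (yes; no)

-- Arithmetic helpers (the divisor is always ≥ 1 where these are used;
-- the zero-divisor clause is an arbitrary convention never exercised).

modN : ℕ → ℕ → ℕ
modN m zero    = m
modN m (suc d) = m % suc d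

ceilDiv : ℕ → ℕ → ℕ
ceilDiv m zero    = 0
ceilDiv m (suc d) = (m + d) / suc d

bitVal : Bool → ℕ
bitVal true  = 1
bitVal false = 0

sumTo : ℕ → (ℕ → ℕ) → ℕ
sumTo zero    f = 0
sumTo (suc m) f = sumTo m f + f m

BoolFun : ℕ → Set
BoolFun n = (Fin n → Bool) → Bool

-- value of variable number q of X (variables with q ≥ n do not exist;
-- they are read as 0)
bitAt : {n : ℕ} → (Fin n → Bool) → ℕ → Bool
bitAt {n} X q with q <? n
... | yes q<n = X (fromℕ< q<n)
... | no  _   = false

module SAFDef (n k w : ℕ) where

  LK : ℕ
  LK = ⌈log₂ k ⌉

  LW : ℕ
  LW = ⌈log₂ (2 * w) ⌉

  nBlocks : ℕ
  nBlocks = 2 * k * w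

  a : ℕ
  a = ceilDiv n nBlocks

  b : ℕ
  b = a ∸ (LK + LW)

  module _ (X : Fin n → Bool) where

    blockVar : ℕ → ℕ → Bool
    blockVar p j = bitAt X (p * a + j)

    y : ℕ → ℕ → Bool
    y p j = blockVar p j

    x : ℕ → ℕ → Bool
    x p j = blockVar p (LK + LW + j)

    AdrK : ℕ → ℕ
    AdrK p = modN (sumTo LK (λ j → bitVal (y p j) * 2 ^ j)) k

    AdrW : ℕ → ℕ
    AdrW p = modN (sumTo LW (λ j → bitVal (y p (j + LK)) * 2 ^ j)) (2 * w)

    firstSat : (ℕ → Bool) → List ℕ → Maybe ℕ
    firstSat P []       = nothing
    firstSat P (p ∷ ps) = if P p then just p else firstSat P ps

    eqℕ : ℕ → ℕ → Bool
    eqℕ m m' = Data.Nat._≡ᵇ_ m m'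

    -- Ind(X,i,t); nothing represents -1
    Ind : ℕ → ℕ → Maybe ℕ
    Ind i t = firstSat (λ p → if eqℕ (AdrK p) t then eqℕ (AdrW p) i else false)
                       (upTo nBlocks)

    -- Val(X,i,t); nothing represents -1
    Val : ℕ → ℕ → Maybe ℕ
    Val i t with Ind i t
    ... | nothing = nothing
    ... | just p  = just (modN (sumTo b (λ j → bitVal (x p j))) w)

    -- Step₁(X,t) for t ≥ 0 and Step₂(X,t-1) (index shifted by one so that
    -- Step₂' 0 = Step₂(X,-1) = 0); nothing represents -1
    mutual
      Step₁ : ℕ → Maybe ℕ
      Step₁ t with Step₂' t
      ... | nothing = nothing
      ... | just i with Val i t
      ...   | nothing = nothing
      ...   | just v  = just (v + w)

      Step₂' : ℕ → Maybe ℕ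
      Step₂' zero = just 0
      Step₂' (suc t) with Step₁ t
      ... | nothing = nothing
      ... | just i  = Val i t

    Step₂ : ℕ → Maybe ℕ
    Step₂ t = Step₂' (suc t)

    -- SAF = 0 iff Step₂(X,k-1) ≤ 0, i.e. Step₂(X,k-1) ∈ {-1, 0}
    SAFval : Bool
    SAFval with Step₂ (k ∸ 1)
    ... | nothing      = false
    ... | just zero    = false
    ... | just (suc _) = true

SAF : (n k w : ℕ) → BoolFun n
SAF n k w X = SAFDef.SAFval n k w X

allBits : ℕ → List (List Bool)
allBits zero    = [] ∷ []
allBits (suc m) = concatMap (λ v → (false ∷ v) ∷ (true ∷ v) ∷ []) (allBits m)

nth : List Bool → ℕ → Bool
nth []       _       = false
nth (c ∷ cs) zero    = c
nth (c ∷ cs) (suc i) = nth cs i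

-- The permutation θ = (j_1,…,j_n) is given as θ ⟨$⟩ʳ i = x_{j_{i+1}}.
-- An assignment Z to the variables in θ-order (Z i = value of x_{j_{i+1}})
-- is turned into an assignment to x_0 … x_{n-1}.
reorder : {n : ℕ} → Permutation′ n → List Bool → (Fin n → Bool)
reorder θ Z v = nth Z (toℕ (θ ⟨$⟩ˡ v))

-- The subfunction f|_ρ for the partition ({x_{j_1},…,x_{j_u}}, rest),
-- ρ ∈ {0,1}^u, represented by its full truth table over the n - u
-- remaining variables (in θ-order).
subfun : {n : ℕ} → BoolFun n → Permutation′ n → ℕ → List Bool → List Bool
subfun {n} f θ u ρ = map (λ σ → f (reorder θ (ρ ++ σ))) (allBits (n ∸ u))

Npart : {n : ℕ} → BoolFun n → Permutation′ n → ℕ → ℕ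
Npart f θ u =
  length (deduplicate (≡-dec BoolP._≟_) (map (subfun f θ u) (allBits u)))

-- N^θ(f) = max over the cut points u = 2, …, n-1 (i.e. 1 < u < n)
Nperm : {n : ℕ} → BoolFun n → Permutation′ n → ℕ
Nperm {n} f θ = foldr _⊔_ 0 (map (λ i → Npart f θ (2 + i)) (upTo (n ∸ 2)))

-- Cut the variable order after u variables and call a block heavy when at least w - 1 of its
-- value variables lie before the cut.  Moving the cut by one variable changes at most one block,
-- so for some cut exactly (k - 1)(w - 2) of the first 2kw - k - w + 1 blocks are heavy.  The
-- heavy blocks take the addresses (t, i), 1 ≤ t < k, 1 ≤ i ≤ w - 2, and store the base-w digits
-- of a number c < w ^ ((k - 1)(w - 2)) using prefix variables only.  The light blocks, written
-- with suffix variables only, fill the addresses (t, w + x) with a table and (t, w - 1) with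
-- the value 0.  For a test (e, v) the table lets Step₂ idle in state w - 1, jump to the address
-- of digit e at its time, and then continue positively iff the digit equals v; otherwise the
-- run drops to 0, an address unused after time 0, and dies.  Hence numbers differing in a
-- digit have different subfunctions.

module Submission where

open import Data.Bool using (Bool; true; false; not; _∧_; if_then_else_; T)
import Data.Bool.Properties as Bool
open import Data.Empty using (⊥; ⊥-elim)
open import Data.Fin using (Fin; zero; suc; toℕ; fromℕ<)
import Data.Fin as Fin
open import Data.Fin.Properties using (toℕ-fromℕ<; toℕ<n; toℕ-injective; injective⇒≤)
open import Data.Fin.Permutation using (Permutation′; _⟨$⟩ˡ_; _⟨$⟩ʳ_; inverseʳ)
open import Data.List using (List; []; _∷_; map; foldr; length; applyUpTo; upTo; _++_; lookup)
open import Data.List.Properties using (≡-dec; ∷-injective; length-applyUpTo)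
open import Data.List.Membership.Propositional using (_∈_)
open import Data.List.Membership.Propositional.Properties using (∈-map⁺; ∈-deduplicate⁺; ∈-upTo⁺; ∈-upTo⁻; ∈-concat⁺′)
open import Data.List.Relation.Unary.Any using (here; there; index)
open import Data.List.Relation.Unary.Any.Properties using (lookup-index)
open import Data.Maybe using (Maybe; just; nothing)
open import Data.Nat
open import Data.Nat.DivMod
open import Data.Nat.Induction using (<-wellFounded)
open import Data.Nat.Logarithm using (⌈log₂_⌉)
open import Data.Nat.Logarithm.Core using (⌈log2⌉)
open import Data.Nat.Properties
open import Data.Nat.Tactic.RingSolver using (solve-∀)
open import Algebra.Properties.CommutativeSemigroup +-commutativeSemigroup using (interchange)
open import Data.Product using (∃; _×_; _,_; proj₁; proj₂)
open import Data.Sum using (inj₁; inj₂)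
open import Function using (_∘_)
open import Function.Definitions using (Injective)
open import Induction.WellFounded using (Acc; acc)
open import Relation.Binary.PropositionalEquality
open import Relation.Nullary using (Dec; yes; no; ¬_)
open import Relation.Nullary.Reflects using (Reflects; ofʸ; ofⁿ; fromEquivalence; det)

open import Defs

≡ᵇ-reflects-≡ : ∀ m n → Reflects (m ≡ n) (m ≡ᵇ n)
≡ᵇ-reflects-≡ m n = fromEquivalence (≡ᵇ⇒≡ m n) (≡⇒≡ᵇ m n)

≡⇒≡ᵇ≡true : ∀ {m n} → m ≡ n → (m ≡ᵇ n) ≡ true
≡⇒≡ᵇ≡true {m} {n} m≡n = det (≡ᵇ-reflects-≡ m n) (ofʸ m≡n)

≢⇒≡ᵇ≡false : ∀ {m n} → m ≢ n → (m ≡ᵇ n) ≡ false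
≢⇒≡ᵇ≡false {m} {n} m≢n = det (≡ᵇ-reflects-≡ m n) (ofⁿ m≢n)

<⇒<ᵇ≡true : ∀ {m n} → m < n → (m <ᵇ n) ≡ true
<⇒<ᵇ≡true {m} {n} m<n = det (<ᵇ-reflects-< m n) (ofʸ m<n)

≮⇒<ᵇ≡false : ∀ {m n} → ¬ m < n → (m <ᵇ n) ≡ false
≮⇒<ᵇ≡false {m} {n} m≮n = det (<ᵇ-reflects-< m n) (ofⁿ m≮n)

≤⇒≤ᵇ≡true : ∀ {m n} → m ≤ n → (m ≤ᵇ n) ≡ true
≤⇒≤ᵇ≡true {m} {n} m≤n = det (≤ᵇ-reflects-≤ m n) (ofʸ m≤n)

≰⇒≤ᵇ≡false : ∀ {m n} → ¬ m ≤ n → (m ≤ᵇ n) ≡ false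
≰⇒≤ᵇ≡false {m} {n} m≰n = det (≤ᵇ-reflects-≤ m n) (ofⁿ m≰n)

≤ᵇ≡true⇒≤ : ∀ {m n} → (m ≤ᵇ n) ≡ true → m ≤ n
≤ᵇ≡true⇒≤ {m} {n} m≤ᵇn with m ≤ᵇ n | ≤ᵇ-reflects-≤ m n
... | true | ofʸ m≤n = m≤n

≤ᵇ≡false⇒> : ∀ {m n} → (m ≤ᵇ n) ≡ false → n < m
≤ᵇ≡false⇒> {m} {n} m≰ᵇn with m ≤ᵇ n | ≤ᵇ-reflects-≤ m n
... | false | ofⁿ m≰n = ≰⇒> m≰n

if-true : ∀ {A : Set} {b} {x y : A} → b ≡ true → (if b then x else y) ≡ x
if-true refl = refl

if-false : ∀ {A : Set} {b} {x y : A} → b ≡ false → (if b then x else y) ≡ y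
if-false refl = refl

sumTo-cong : ∀ N {f g : ℕ → ℕ} → (∀ j → j < N → f j ≡ g j) → sumTo N f ≡ sumTo N g
sumTo-cong zero    f≗g = refl
sumTo-cong (suc N) f≗g = cong₂ _+_ (sumTo-cong N (λ j j<N → f≗g j (m<n⇒m<1+n j<N))) (f≗g N ≤-refl)

sumTo-monoˡ-≤ : ∀ {M N} (f : ℕ → ℕ) → M ≤ N → sumTo M f ≤ sumTo N f
sumTo-monoˡ-≤ {M} {N} f M≤N with m≤n⇒∃[o]m+o≡n M≤N
... | d , refl = go d
  where
  go : ∀ d → sumTo M f ≤ sumTo (M + d) f
  go zero    rewrite +-identityʳ M = ≤-refl
  go (suc d) rewrite +-suc M d = ≤-trans (go d) (m≤m+n _ _)

count : (ℕ → Bool) → ℕ → ℕ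
count P N = sumTo N (λ j → bitVal (P j))

bitVal≤1 : ∀ b → bitVal b ≤ 1
bitVal≤1 true  = ≤-refl
bitVal≤1 false = z≤n

count-cong : ∀ N {P Q : ℕ → Bool} → (∀ j → j < N → P j ≡ Q j) → count P N ≡ count Q N
count-cong N P≗Q = sumTo-cong N (λ j j<N → cong bitVal (P≗Q j j<N))

count-all : ∀ N {P : ℕ → Bool} → (∀ j → j < N → P j ≡ true) → count P N ≡ N
count-all N {P} all = trans (count-cong N all) (go N)
  where
  go : ∀ N → count (λ _ → true) N ≡ N
  go zero    = refl
  go (suc N) = trans (cong (_+ 1) (go N)) (+-comm N 1)

count-+-count-not : ∀ (P : ℕ → Bool) N → count P N + count (λ j → not (P j)) N ≡ N
count-+-count-not P zero    = refl
count-+-count-not P (suc N) = begin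
  count P N + bitVal (P N) + (count P′ N + bitVal (not (P N)))
    ≡⟨ interchange (count P N) (bitVal (P N)) (count P′ N) (bitVal (not (P N))) ⟩
  count P N + count P′ N + (bitVal (P N) + bitVal (not (P N)))
    ≡⟨ cong₂ _+_ (count-+-count-not P N) (bitVal-split (P N)) ⟩
  N + 1
    ≡⟨ +-comm N 1 ⟩
  suc N ∎
  where
  open ≡-Reasoning
  P′ : ℕ → Bool
  P′ j = not (P j)
  bitVal-split : ∀ b → bitVal b + bitVal (not b) ≡ 1
  bitVal-split true  = refl
  bitVal-split false = refl

count-pointwise-update : ∀ N {P Q : ℕ → Bool} j₀ →
  (∀ j → j < N → j ≢ j₀ → P j ≡ Q j) → count P N ≤ suc (count Q N)
count-pointwise-update zero    j₀ P≗Q = z≤n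
count-pointwise-update (suc N) {P} {Q} j₀ P≗Q with N ≟ j₀
... | yes refl = begin
  count P N + bitVal (P N)  ≤⟨ +-mono-≤ (≤-reflexive (count-cong N (λ j j<N → P≗Q j (m<n⇒m<1+n j<N) (<⇒≢ j<N)))) (bitVal≤1 (P N)) ⟩
  count Q N + 1             ≡⟨ +-comm (count Q N) 1 ⟩
  suc (count Q N)           ≤⟨ s≤s (m≤m+n _ _) ⟩
  suc (count Q N + bitVal (Q N)) ∎
  where open ≤-Reasoning
... | no N≢j₀ = begin
  count P N + bitVal (P N)         ≤⟨ +-monoˡ-≤ _ (count-pointwise-update N j₀ (λ j j<N → P≗Q j (m<n⇒m<1+n j<N))) ⟩
  suc (count Q N) + bitVal (P N)   ≡⟨ cong (λ b → suc (count Q N + bitVal b)) (P≗Q N ≤-refl N≢j₀) ⟩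
  suc (count Q N + bitVal (Q N))   ∎
  where open ≤-Reasoning

rank<count : ∀ (P : ℕ → Bool) {p N} → P p ≡ true → p < N → count P p < count P N
rank<count P {p} {N} Pp p<N = begin-strict
  count P p               <⟨ n<1+n _ ⟩
  suc (count P p)         ≡⟨ +-comm 1 (count P p) ⟩
  count P p + 1           ≡⟨ cong (λ b → count P p + bitVal b) (sym Pp) ⟩
  count P (suc p)         ≤⟨ sumTo-monoˡ-≤ _ p<N ⟩
  count P N ∎
  where open ≤-Reasoning

rank-surjective : ∀ (P : ℕ → Bool) N {e} → e < count P N →
  ∃ λ p → p < N × P p ≡ true × count P p ≡ e
rank-surjective P (suc N) {e} e<count with e <? count P N | P N in PN
... | yes e<cN | _     = let p , p<N , Pp , rank = rank-surjective P N e<cN in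
                         p , m<n⇒m<1+n p<N , Pp , rank
... | no e≮cN  | true  = N , ≤-refl , PN , ≤-antisym (≮⇒≥ e≮cN) (≤-pred (subst (e <_) (+-comm (count P N) 1) e<count))
... | no e≮cN  | false = ⊥-elim (e≮cN (subst (e <_) (+-identityʳ _) e<count))

count-first : ∀ (P : ℕ → Bool) d N →
  sumTo N (λ j → bitVal (P j ∧ (count P j <ᵇ d))) ≡ d ⊓ count P N
count-first P d zero    = sym (⊓-zeroʳ d)
count-first P d (suc N) with P N | count P N <ᵇ d | <ᵇ-reflects-< (count P N) d
... | false | _     | _       = trans (+-identityʳ _) (trans (count-first P d N) (cong (d ⊓_) (sym (+-identityʳ _))))
... | true  | true  | ofʸ c<d = begin
  sumTo N _ + 1          ≡⟨ cong (_+ 1) (count-first P d N) ⟩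
  d ⊓ count P N + 1      ≡⟨ cong (_+ 1) (m≥n⇒m⊓n≡n (<⇒≤ c<d)) ⟩
  count P N + 1          ≡⟨ m≥n⇒m⊓n≡n (subst (_≤ d) (+-comm 1 _) c<d) ⟨
  d ⊓ (count P N + 1)    ∎
  where open ≡-Reasoning
... | true  | false | ofⁿ c≮d = begin
  sumTo N _ + 0          ≡⟨ +-identityʳ _ ⟩
  sumTo N _              ≡⟨ count-first P d N ⟩
  d ⊓ count P N          ≡⟨ m≤n⇒m⊓n≡m (≮⇒≥ c≮d) ⟩
  d                      ≡⟨ m≤n⇒m⊓n≡m (≤-trans (≮⇒≥ c≮d) (m≤m+n _ 1)) ⟨
  d ⊓ (count P N + 1)    ∎
  where open ≡-Reasoning

count-none : ∀ N {P : ℕ → Bool} → (∀ j → j < N → P j ≡ false) → count P N ≡ 0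
count-none N {P} none = trans (count-cong N none) (go N)
  where
  go : ∀ N → count (λ _ → false) N ≡ 0
  go zero    = refl
  go (suc N) = trans (+-identityʳ _) (go N)

intermediate-value : ∀ (A : ℕ → ℕ) → (∀ u → A (suc u) ≤ suc (A u)) →
  ∀ {lo hi N} → lo ≤ hi → A lo < N → N ≤ A hi → ∃ λ u → lo < u × u ≤ hi × A u ≡ N
intermediate-value A step {lo} {zero} {N} z≤n Alo<N N≤Ahi = ⊥-elim (<⇒≱ Alo<N N≤Ahi)
intermediate-value A step {lo} {suc h} {N} lo≤hi Alo<N N≤Ahi with m≤n⇒m<n∨m≡n lo≤hi
... | inj₂ refl = ⊥-elim (<⇒≱ Alo<N N≤Ahi)
... | inj₁ lo≤h with N ≤? A h
...   | yes N≤Ah = let u , lo<u , u≤h , Au≡N = intermediate-value A step (≤-pred lo≤h) Alo<N N≤Ah in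
                   u , lo<u , m≤n⇒m≤1+n u≤h , Au≡N
...   | no N≰Ah  = suc h , lo≤h , ≤-refl , ≤-antisym (≤-trans (step h) (≰⇒> N≰Ah)) N≤Ahi

-- Binary and base-w digits

sumTo-suc : ∀ N (f : ℕ → ℕ) → sumTo (suc N) f ≡ f 0 + sumTo N (λ j → f (suc j))
sumTo-suc zero    f = +-comm 0 (f 0)
sumTo-suc (suc N) f = trans (cong (_+ f (suc N)) (sumTo-suc N f)) (+-assoc (f 0) _ _)

sumTo-*ˡ : ∀ N c (f : ℕ → ℕ) → sumTo N (λ j → c * f j) ≡ c * sumTo N f
sumTo-*ˡ zero    c f = sym (*-zeroʳ c)
sumTo-*ˡ (suc N) c f = trans (cong (_+ c * f N) (sumTo-*ˡ N c f)) (sym (*-distribˡ-+ c _ _))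

bit : ℕ → ℕ → Bool
bit t zero    = t % 2 ≡ᵇ 1
bit t (suc j) = bit (t / 2) j

bit-zero : ∀ j → bit 0 j ≡ false
bit-zero zero    = refl
bit-zero (suc j) = bit-zero j

binary-expansion : ∀ L t → t < 2 ^ L → sumTo L (λ j → bitVal (bit t j) * 2 ^ j) ≡ t
binary-expansion zero    zero    _         = refl
binary-expansion zero    (suc t) (s≤s ())
binary-expansion (suc L) t t<2^L = begin
  sumTo (suc L) (λ j → bitVal (bit t j) * 2 ^ j)
    ≡⟨ sumTo-suc L _ ⟩
  bitVal (bit t 0) * 1 + sumTo L (λ j → bitVal (bit (t / 2) j) * (2 * 2 ^ j))
    ≡⟨ cong₂ _+_ (trans (*-identityʳ _) (lowest-bit t)) (sumTo-cong L (λ j _ → x*[2*y]≡2*[x*y] (bitVal (bit (t / 2) j)) (2 ^ j))) ⟩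
  t % 2 + sumTo L (λ j → 2 * (bitVal (bit (t / 2) j) * 2 ^ j))
    ≡⟨ cong (t % 2 +_) (sumTo-*ˡ L 2 _) ⟩
  t % 2 + 2 * sumTo L (λ j → bitVal (bit (t / 2) j) * 2 ^ j)
    ≡⟨ cong (λ s → t % 2 + 2 * s) (binary-expansion L (t / 2) (m<n*o⇒m/o<n (subst (t <_) (*-comm 2 (2 ^ L)) t<2^L))) ⟩
  t % 2 + 2 * (t / 2)
    ≡⟨ trans (cong (t % 2 +_) (*-comm 2 (t / 2))) (sym (m≡m%n+[m/n]*n t 2)) ⟩
  t ∎
  where
  open ≡-Reasoning
  x*[2*y]≡2*[x*y] : ∀ x y → x * (2 * y) ≡ 2 * (x * y)
  x*[2*y]≡2*[x*y] = solve-∀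
  lowest-bit : ∀ t → bitVal (t % 2 ≡ᵇ 1) ≡ t % 2
  lowest-bit t with t % 2 | m%n<n t 2
  ... | 0 | _ = refl
  ... | 1 | _ = refl
  ... | suc (suc _) | s≤s (s≤s ())

n≤2^⌈log₂n⌉ : ∀ n → n ≤ 2 ^ ⌈log₂ n ⌉
n≤2^⌈log₂n⌉ n = go n (<-wellFounded n)
  where
  go : ∀ n (rec : Acc _<_ n) → n ≤ 2 ^ ⌈log2⌉ n rec
  go zero          _         = z≤n
  go (suc zero)    _         = s≤s z≤n
  go (suc (suc n)) (acc rec) = begin
    2 + n                  ≡⟨ cong (2 +_) (⌊n/2⌋+⌈n/2⌉≡n n) ⟨
    2 + (⌊ n /2⌋ + ⌈ n /2⌉) ≤⟨ s≤s (s≤s (+-monoˡ-≤ ⌈ n /2⌉ (⌊n/2⌋≤⌈n/2⌉ n))) ⟩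
    2 + (⌈ n /2⌉ + ⌈ n /2⌉) ≡⟨ double-suc ⌈ n /2⌉ ⟩
    2 * suc ⌈ n /2⌉         ≤⟨ *-monoʳ-≤ 2 (go (suc ⌈ n /2⌉) (rec (⌈n/2⌉<n n))) ⟩
    2 * 2 ^ ⌈log2⌉ (suc ⌈ n /2⌉) _ ∎
    where
    open ≤-Reasoning
    double-suc : ∀ x → 2 + (x + x) ≡ 2 * suc x
    double-suc = solve-∀

module Digits (w : ℕ) .{{_ : NonZero w}} where

  digit : ℕ → ℕ → ℕ
  digit c zero    = c % w
  digit c (suc e) = digit (c / w) e

  digit<base : ∀ c e → digit c e < w
  digit<base c zero    = m%n<n c w
  digit<base c (suc e) = digit<base (c / w) e

  digits-distinguish : ∀ N {c c′} → c < w ^ N → c′ < w ^ N → c ≢ c′ →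
    ∃ λ e → e < N × digit c e ≢ digit c′ e
  digits-distinguish zero    c<1 c′<1 c≢c′ = ⊥-elim (c≢c′ (trans (n<1⇒n≡0 c<1) (sym (n<1⇒n≡0 c′<1))))
  digits-distinguish (suc N) {c} {c′} c< c′< c≢c′ with c % w ≟ c′ % w
  ... | no  r≢ = 0 , z<s , r≢
  ... | yes r≡ = let e , e<N , d≢ = digits-distinguish N (quotient< c<) (quotient< c′<) quotients-differ in
                 suc e , s<s e<N , d≢
    where
    quotient< : ∀ {x} → x < w ^ suc N → x / w < w ^ N
    quotient< {x} x< = m<n*o⇒m/o<n (subst (x <_) (*-comm w (w ^ N)) x<)
    quotients-differ : c / w ≢ c′ / w
    quotients-differ q≡ = c≢c′ (begin
      c                  ≡⟨ m≡m%n+[m/n]*n c w ⟩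
      c % w + c / w * w  ≡⟨ cong₂ (λ r q → r + q * w) r≡ q≡ ⟩
      c′ % w + c′ / w * w ≡⟨ m≡m%n+[m/n]*n c′ w ⟨
      c′ ∎)
      where open ≡-Reasoning

module _ (a : ℕ) .{{_ : NonZero a}} where

  [p*a+o]%a≡o : ∀ p {o} → o < a → (p * a + o) % a ≡ o
  [p*a+o]%a≡o p {o} o<a = trans (cong (_% a) (+-comm (p * a) o)) (trans ([m+kn]%n≡m%n o p a) (m<n⇒m%n≡m o<a))

  [p*a+o]/a≡p : ∀ p {o} → o < a → (p * a + o) / a ≡ p
  [p*a+o]/a≡p p {o} o<a = begin
    (p * a + o) / a      ≡⟨ +-distrib-/ (p * a) o (subst (_< a) (sym remainders) o<a) ⟩
    p * a / a + o / a    ≡⟨ cong₂ _+_ (m*n/n≡m p a) (m<n⇒m/n≡0 o<a) ⟩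
    p + 0                ≡⟨ +-identityʳ p ⟩
    p ∎
    where
    open ≡-Reasoning
    remainders : (p * a) % a + o % a ≡ o
    remainders = cong₂ _+_ (m*n%n≡0 p a) (m<n⇒m%n≡m o<a)

<-ceilDiv : ∀ {n m c} .{{_ : NonZero m}} → m * c < n → c < ceilDiv n m
<-ceilDiv {n} {suc d} {c} mc<n = begin-strict
  c                      <⟨ n<1+n c ⟩
  suc c                  ≡⟨ m*n/n≡m (suc c) (suc d) ⟨
  suc c * suc d / suc d  ≤⟨ /-monoˡ-≤ (suc d) (≤-trans (≤-reflexive (expand c d)) (+-monoˡ-≤ d mc<n)) ⟩
  (n + d) / suc d        ∎
  where
  open ≤-Reasoning
  expand : ∀ c d → suc c * suc d ≡ suc (suc d * c) + d
  expand = solve-∀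

ceilDiv*≤ : ∀ n m .{{_ : NonZero m}} → ceilDiv n m * m ≤ n + m
ceilDiv*≤ n (suc d) = ≤-trans (m/n*n≤m (n + d) (suc d)) (+-monoʳ-≤ n (n≤1+n d))

-- The rounding in ⌈ n / m ⌉ costs at most m, which the D spare blocks of size c absorb.
*ceilDiv≤ : ∀ {n m R D c} .{{_ : NonZero m}} → R + D ≡ m → R ≤ D * c → m * c ≤ n →
  R * ceilDiv n m ≤ n
*ceilDiv≤ {n} {m} {R} {D} {c} R+D≡m R≤Dc mc≤n = *-cancelˡ-≤ m (begin
  m * (R * a)     ≡⟨ rearrange m R a ⟩
  R * (a * m)     ≤⟨ *-monoʳ-≤ R (ceilDiv*≤ n m) ⟩
  R * (n + m)     ≡⟨ *-distribˡ-+ R n m ⟩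
  R * n + R * m   ≤⟨ +-monoʳ-≤ (R * n) Rm≤Dn ⟩
  R * n + D * n   ≡⟨ *-distribʳ-+ n R D ⟨
  (R + D) * n     ≡⟨ cong (_* n) R+D≡m ⟩
  m * n           ∎)
  where
  open ≤-Reasoning
  a : ℕ
  a = ceilDiv n m
  rearrange : ∀ x y z → x * (y * z) ≡ y * (z * x)
  rearrange = solve-∀
  Rm≤Dn : R * m ≤ D * n
  Rm≤Dn = begin
    R * m        ≤⟨ *-monoˡ-≤ m R≤Dc ⟩
    D * c * m    ≡⟨ *-assoc D c m ⟩
    D * (c * m)  ≤⟨ *-monoʳ-≤ D (subst (_≤ n) (*-comm m c) mc≤n) ⟩
    D * n        ∎

-- Subfunctions and the measure N

nth-applyUpTo : ∀ (f : ℕ → Bool) {N i} → i < N → nth (applyUpTo f N) i ≡ f i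
nth-applyUpTo f {suc N} {zero}  _         = refl
nth-applyUpTo f {suc N} {suc i} (s<s i<N) = nth-applyUpTo (λ j → f (suc j)) i<N

nth-++ˡ : ∀ (xs ys : List Bool) {i} → i < length xs → nth (xs ++ ys) i ≡ nth xs i
nth-++ˡ (x ∷ xs) ys {zero}  _         = refl
nth-++ˡ (x ∷ xs) ys {suc i} (s<s i<l) = nth-++ˡ xs ys i<l

nth-++ʳ : ∀ (xs ys : List Bool) i → nth (xs ++ ys) (length xs + i) ≡ nth ys i
nth-++ʳ []       ys i = refl
nth-++ʳ (x ∷ xs) ys i = nth-++ʳ xs ys i

∈-allBits : ∀ (xs : List Bool) → xs ∈ allBits (length xs)
∈-allBits []       = here refl
∈-allBits (b ∷ xs) = ∈-concat⁺′ (b∷v∈extensions b) (∈-map⁺ _ (∈-allBits xs))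
  where
  b∷v∈extensions : ∀ b {v : List Bool} → (b ∷ v) ∈ ((false ∷ v) ∷ (true ∷ v) ∷ [])
  b∷v∈extensions false = here refl
  b∷v∈extensions true  = there (here refl)

map-≡⇒≡ : ∀ {A B : Set} {f g : A → B} {xs x} → map f xs ≡ map g xs → x ∈ xs → f x ≡ g x
map-≡⇒≡ {xs = y ∷ xs} fxs≡gxs (here refl) = proj₁ (∷-injective fxs≡gxs)
map-≡⇒≡ {xs = y ∷ xs} fxs≡gxs (there x∈xs) = map-≡⇒≡ (proj₂ (∷-injective fxs≡gxs)) x∈xs

injection⇒≤length : ∀ {A : Set} {M} (xs : List A) (f : Fin M → A) →
  Injective _≡_ _≡_ f → (∀ i → f i ∈ xs) → M ≤ length xs
injection⇒≤length xs f f-inj f∈xs = injective⇒≤ position-injective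
  where
  position-injective : Injective _≡_ _≡_ (λ i → index (f∈xs i))
  position-injective {i} {j} same-position = f-inj (begin
    f i                        ≡⟨ lookup-index (f∈xs i) ⟩
    lookup xs (index (f∈xs i)) ≡⟨ cong (lookup xs) same-position ⟩
    lookup xs (index (f∈xs j)) ≡⟨ lookup-index (f∈xs j) ⟨
    f j                        ∎)
    where open ≡-Reasoning

≤-foldr-⊔ : ∀ {x xs} → x ∈ xs → x ≤ foldr _⊔_ 0 xs
≤-foldr-⊔ (here refl)   = m≤m⊔n _ _
≤-foldr-⊔ (there x∈xs) = ≤-trans (≤-foldr-⊔ x∈xs) (m≤n⊔m _ _)

module _ {n} (f : BoolFun n) (θ : Permutation′ n) where

  subfun-≡⇒≡ : ∀ {u ρ ρ′} σ → length σ ≡ n ∸ u → subfun f θ u ρ ≡ subfun f θ u ρ′ →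
    f (reorder θ (ρ ++ σ)) ≡ f (reorder θ (ρ′ ++ σ))
  subfun-≡⇒≡ σ |σ|≡ same = map-≡⇒≡ same (subst (λ l → σ ∈ allBits l) |σ|≡ (∈-allBits σ))

  Npart-≥ : ∀ u {M} (ρ : Fin M → List Bool) → (∀ c → length (ρ c) ≡ u) →
    Injective _≡_ _≡_ (λ c → subfun f θ u (ρ c)) → M ≤ Npart f θ u
  Npart-≥ u ρ |ρ|≡ distinct = injection⇒≤length _ _ distinct (λ c →
    ∈-deduplicate⁺ (≡-dec Bool._≟_) (∈-map⁺ (subfun f θ u) (subst (λ l → ρ c ∈ allBits l) (|ρ|≡ c) (∈-allBits (ρ c)))))

  Npart≤Nperm : ∀ {u} → 1 < u → u < n → Npart f θ u ≤ Nperm f θ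
  Npart≤Nperm {u} 1<u u<n = subst (λ v → Npart f θ v ≤ Nperm f θ) (m+[n∸m]≡n 1<u)
    (≤-foldr-⊔ (∈-map⁺ (λ i → Npart f θ (2 + i)) (∈-upTo⁺ (∸-monoˡ-< u<n 1<u))))

  1≤Nperm : 2 < n → 1 ≤ Nperm f θ
  1≤Nperm 2<n = ≤-trans (Npart-≥ 2 (λ _ → false ∷ false ∷ []) (λ _ → refl) Fin1-injective) (Npart≤Nperm ≤-refl 2<n)
    where
    Fin1-injective : ∀ {A : Set} {g : Fin 1 → A} → Injective _≡_ _≡_ g
    Fin1-injective {x = zero} {y = zero} _ = refl

bitAt-≥ : ∀ {n} (X : Fin n → Bool) {q} → n ≤ q → bitAt X q ≡ false
bitAt-≥ {n} X {q} n≤q with q <? n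
... | yes q<n = ⊥-elim (<⇒≱ q<n n≤q)
... | no  _   = refl

module Positions {n} (θ : Permutation′ n) where

  position : ℕ → ℕ
  position q with q <? n
  ... | yes q<n = toℕ (θ ⟨$⟩ˡ fromℕ< q<n)
  ... | no  _   = n

  variableAt : ℕ → ℕ
  variableAt i with i <? n
  ... | yes i<n = toℕ (θ ⟨$⟩ʳ fromℕ< i<n)
  ... | no  _   = n

  position≡ : ∀ {q} (q<n : q < n) → position q ≡ toℕ (θ ⟨$⟩ˡ fromℕ< q<n)
  position≡ {q} q<n with q <? n
  ... | yes _   = refl
  ... | no  q≮n = ⊥-elim (q≮n q<n)

  position< : ∀ {q} → q < n → position q < n
  position< q<n = subst (_< n) (sym (position≡ q<n)) (toℕ<n _)

  variableAt-position : ∀ {q} → q < n → variableAt (position q) ≡ q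
  variableAt-position {q} q<n with position q <? n
  ... | no  p≮n = ⊥-elim (p≮n (position< q<n))
  ... | yes p<n = begin
    toℕ (θ ⟨$⟩ʳ fromℕ< p<n)                        ≡⟨ cong (λ i → toℕ (θ ⟨$⟩ʳ i)) (toℕ-injective (trans (toℕ-fromℕ< p<n) (position≡ q<n))) ⟩
    toℕ (θ ⟨$⟩ʳ (θ ⟨$⟩ˡ fromℕ< q<n))               ≡⟨ cong toℕ (inverseʳ θ) ⟩
    toℕ (fromℕ< q<n)                               ≡⟨ toℕ-fromℕ< q<n ⟩
    q ∎
    where open ≡-Reasoning

  bitAt-reorder : ∀ Z {q} → q < n → bitAt (reorder θ Z) q ≡ nth Z (position q)
  bitAt-reorder Z {q} q<n with q <? n
  ... | yes _   = refl
  ... | no  q≮n = ⊥-elim (q≮n q<n)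

  prefix : (ℕ → Bool) → ℕ → List Bool
  prefix Z u = applyUpTo (λ i → Z (variableAt i)) u

  suffix : (ℕ → Bool) → ℕ → List Bool
  suffix Z u = applyUpTo (λ i → Z (variableAt (u + i))) (n ∸ u)

  reorder-prefix++suffix : ∀ u (Z ZA ZB : ℕ → Bool) →
    (∀ q → q < n → position q < u → ZA q ≡ Z q) →
    (∀ q → q < n → u ≤ position q → ZB q ≡ Z q) →
    (∀ q → n ≤ q → Z q ≡ false) →
    ∀ q → bitAt (reorder θ (prefix ZA u ++ suffix ZB u)) q ≡ Z q
  reorder-prefix++suffix u Z ZA ZB ZA≗Z ZB≗Z Z-outside q = by-cases (q <? n)
    where
    open ≡-Reasoning
    |prefix| : length (prefix ZA u) ≡ u
    |prefix| = length-applyUpTo _ u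
    read : q < n → Dec (position q < u) → nth (prefix ZA u ++ suffix ZB u) (position q) ≡ Z q
    read q<n (yes p<u) = begin
      nth (prefix ZA u ++ suffix ZB u) (position q)  ≡⟨ nth-++ˡ (prefix ZA u) (suffix ZB u) (subst (position q <_) (sym |prefix|) p<u) ⟩
      nth (prefix ZA u) (position q)                 ≡⟨ nth-applyUpTo (λ i → ZA (variableAt i)) p<u ⟩
      ZA (variableAt (position q))                   ≡⟨ cong ZA (variableAt-position q<n) ⟩
      ZA q                                           ≡⟨ ZA≗Z q q<n p<u ⟩
      Z q ∎
    read q<n (no p≮u) = begin
      nth (prefix ZA u ++ suffix ZB u) (position q)  ≡⟨ cong (nth (prefix ZA u ++ suffix ZB u)) (trans (cong (_+ (position q ∸ u)) |prefix|) (m+[n∸m]≡n u≤p)) ⟨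
      nth (prefix ZA u ++ suffix ZB u) (length (prefix ZA u) + (position q ∸ u))
                                                     ≡⟨ nth-++ʳ (prefix ZA u) (suffix ZB u) (position q ∸ u) ⟩
      nth (suffix ZB u) (position q ∸ u)             ≡⟨ nth-applyUpTo (λ i → ZB (variableAt (u + i))) (∸-monoˡ-< (position< q<n) u≤p) ⟩
      ZB (variableAt (u + (position q ∸ u)))         ≡⟨ cong (λ i → ZB (variableAt i)) (m+[n∸m]≡n u≤p) ⟩
      ZB (variableAt (position q))                   ≡⟨ cong ZB (variableAt-position q<n) ⟩
      ZB q                                           ≡⟨ ZB≗Z q q<n u≤p ⟩
      Z q ∎
      where
      u≤p : u ≤ position q
      u≤p = ≮⇒≥ p≮u
    by-cases : Dec (q < n) → bitAt (reorder θ (prefix ZA u ++ suffix ZB u)) q ≡ Z q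
    by-cases (no  q≮n) = trans (bitAt-≥ (reorder θ (prefix ZA u ++ suffix ZB u)) (≮⇒≥ q≮n)) (sym (Z-outside q (≮⇒≥ q≮n)))
    by-cases (yes q<n) = trans (bitAt-reorder (prefix ZA u ++ suffix ZB u) q<n) (read q<n (position q <? u))

-- Evaluating SAF

induction-from : ∀ (P : ℕ → Set) {lo hi} → P lo → (∀ {t} → lo ≤ t → t < hi → P t → P (suc t)) →
  ∀ {t} → lo ≤ t → t ≤ hi → P t
induction-from P base step lo≤t t≤hi with m≤n⇒m<n∨m≡n lo≤t
... | inj₂ refl = base
induction-from P base step {suc t} _ t<hi | inj₁ (s≤s lo≤t) =
  step lo≤t t<hi (induction-from P base step lo≤t (<⇒≤ t<hi))

-- Step values ≤ 0; nothing stands for -1.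
data NonPositive : Maybe ℕ → Set where
  minus-one : NonPositive nothing
  zero      : NonPositive (just 0)

module SAFProperties {n k w : ℕ} (X : Fin n → Bool) where
  open SAFDef n k w

  blockValue : ℕ → ℕ
  blockValue p = modN (sumTo b (λ j → bitVal (x X p j))) w

  private
    IsAt : ℕ → ℕ → ℕ → Bool
    IsAt i t p = if AdrK X p ≡ᵇ t then AdrW X p ≡ᵇ i else false

    IsAt⇒≡ : ∀ i t p → IsAt i t p ≡ true → AdrK X p ≡ t × AdrW X p ≡ i
    IsAt⇒≡ i t p at with AdrK X p ≡ᵇ t | ≡ᵇ-reflects-≡ (AdrK X p) t
    ... | true | ofʸ K≡t = K≡t , ≡ᵇ⇒≡ _ _ (subst T (sym at) _)

    ≡⇒IsAt : ∀ i t p → AdrK X p ≡ t → AdrW X p ≡ i → IsAt i t p ≡ true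
    ≡⇒IsAt i t p K≡t W≡i rewrite ≡⇒≡ᵇ≡true K≡t | ≡⇒≡ᵇ≡true W≡i = refl

    firstSat-just : ∀ P xs {p} → firstSat X P xs ≡ just p → P p ≡ true × p ∈ xs
    firstSat-just P (y ∷ ys) found with P y in Py
    firstSat-just P (y ∷ ys) refl | true = Py , here refl
    ... | false = let Pp , p∈ys = firstSat-just P ys found in Pp , there p∈ys

    firstSat-nothing : ∀ P xs {p} → firstSat X P xs ≡ nothing → p ∈ xs → P p ≡ false
    firstSat-nothing P (y ∷ ys) none p∈ with P y in Py
    firstSat-nothing P (y ∷ ys) () p∈ | true
    firstSat-nothing P (y ∷ ys) none (here refl)  | false = Py
    firstSat-nothing P (y ∷ ys) none (there p∈ys) | false = firstSat-nothing P ys none p∈ys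

  Val-present : ∀ {i t v p₀} → p₀ < nBlocks → AdrK X p₀ ≡ t → AdrW X p₀ ≡ i →
    (∀ p → p < nBlocks → AdrK X p ≡ t → AdrW X p ≡ i → blockValue p ≡ v) → Val X i t ≡ just v
  Val-present {i} {t} {p₀ = p₀} p₀<m K≡t W≡i value with Ind X i t in found
  ... | just p  = let at , p∈ = firstSat-just (IsAt i t) (upTo nBlocks) found
                      K≡ , W≡ = IsAt⇒≡ i t p at in
                  cong just (value p (∈-upTo⁻ p∈) K≡ W≡)
  ... | nothing = ⊥-elim (false≢true (trans (sym (firstSat-nothing (IsAt i t) (upTo nBlocks) found (∈-upTo⁺ p₀<m)))
                                            (≡⇒IsAt i t p₀ K≡t W≡i)))
    where
    false≢true : false ≢ true
    false≢true ()

  Val-absent : ∀ {i t} → (∀ p → p < nBlocks → AdrK X p ≡ t → AdrW X p ≢ i) → Val X i t ≡ nothing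
  Val-absent {i} {t} nowhere with Ind X i t in found
  ... | nothing = refl
  ... | just p  = let at , p∈ = firstSat-just (IsAt i t) (upTo nBlocks) found
                      K≡ , W≡ = IsAt⇒≡ i t p at in
                  ⊥-elim (nowhere p (∈-upTo⁻ p∈) K≡ W≡)

  Step₂′-suc : ∀ {t i v} → Step₂' X t ≡ just i → Val X i t ≡ just v → Step₂' X (suc t) ≡ Val X (v + w) t
  Step₂′-suc {t} {i} {v} Sₜ≡i Vᵢ≡v with Step₂' X t | Sₜ≡i
  ... | just .i | refl with Val X i t | Vᵢ≡v
  ...   | just .v | refl = refl

  Step₂′-stuck : ∀ {t i} → Step₂' X t ≡ just i → Val X i t ≡ nothing → Step₂' X (suc t) ≡ nothing
  Step₂′-stuck {t} {i} Sₜ≡i Vᵢ≡- with Step₂' X t | Sₜ≡i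
  ... | just .i | refl with Val X i t | Vᵢ≡-
  ...   | nothing | refl = refl

  Step₂′-dead : ∀ {t} → Step₂' X t ≡ nothing → Step₂' X (suc t) ≡ nothing
  Step₂′-dead {t} Sₜ≡- with Step₂' X t | Sₜ≡-
  ... | nothing | refl = refl

  SAF-positive : ∀ {m} → Step₂ X (k ∸ 1) ≡ just m → 0 < m → SAF n k w X ≡ true
  SAF-positive {suc _} S≡m _ with Step₂ X (k ∸ 1) | S≡m
  ... | just (suc _) | refl = refl

  SAF-nonPositive : NonPositive (Step₂ X (k ∸ 1)) → SAF n k w X ≡ false
  SAF-nonPositive S≤0 with Step₂ X (k ∸ 1) | S≤0
  ... | nothing | minus-one = refl
  ... | just 0  | zero      = refl

-- The designed run of Step₂: state 0 at time 0, the bypass state β afterwards,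
-- except that the table steers into address is just before the tested time ts.
idleState : ℕ → ℕ → ℕ
idleState β zero    = 0
idleState β (suc _) = β

testTable : (β ts is vs : ℕ) → ℕ → ℕ → ℕ
testTable β ts is vs t x =
  if t ≡ᵇ ts then (if x ≡ᵇ vs then β else 0) else (if suc t ≡ᵇ ts then is else β)

testTable-< : ∀ {β ts is vs m} t x → β < m → is < m → testTable β ts is vs t x < m
testTable-< {β} {ts} {is} {vs} t x β<m is<m with t ≡ᵇ ts | x ≡ᵇ vs | suc t ≡ᵇ ts
... | true  | true  | _     = β<m
... | true  | false | _     = ≤-trans z<s β<m
... | false | _     | true  = is<m
... | false | _     | false = β<m

module Walk {n k w : ℕ} (X : Fin n → Bool) {β ts is vs d : ℕ} (0<ts : 0 < ts) (ts<k : ts < k)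
  (idle-val  : ∀ t → t < k → SAFDef.Val n k w X (idleState β t) t ≡ just 0)
  (table-val : ∀ t x → t < k → x < w → SAFDef.Val n k w X (x + w) t ≡ just (testTable β ts is vs t x))
  (test-val  : SAFDef.Val n k w X is ts ≡ just d) (d<w : d < w)
  (dead-val  : ∀ t → 0 < t → t < k → SAFDef.Val n k w X 0 t ≡ nothing) where

  open SAFDef n k w
  open SAFProperties {n} {k} {w} X

  private
    testTable-idle : ∀ {t x} → t ≢ ts → suc t ≢ ts → testTable β ts is vs t x ≡ β
    testTable-idle t≢ts 1+t≢ts rewrite ≢⇒≡ᵇ≡false t≢ts | ≢⇒≡ᵇ≡false 1+t≢ts = refl

    testTable-enter : ∀ {t x} → suc t ≡ ts → testTable β ts is vs t x ≡ is
    testTable-enter {t} refl rewrite ≢⇒≡ᵇ≡false (<⇒≢ (n<1+n t)) | ≡⇒≡ᵇ≡true (refl {x = suc t}) = refl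

    testTable-hit : testTable β ts is vs ts vs ≡ β
    testTable-hit rewrite ≡⇒≡ᵇ≡true (refl {x = ts}) | ≡⇒≡ᵇ≡true (refl {x = vs}) = refl

    testTable-miss : ∀ {x} → x ≢ vs → testTable β ts is vs ts x ≡ 0
    testTable-miss x≢vs rewrite ≡⇒≡ᵇ≡true (refl {x = ts}) | ≢⇒≡ᵇ≡false x≢vs = refl

    idle-step : ∀ {t} → t < k → Step₂' X t ≡ just (idleState β t) → Step₂' X (suc t) ≡ just (testTable β ts is vs t 0)
    idle-step {t} t<k Sₜ≡ = trans (Step₂′-suc Sₜ≡ (idle-val t t<k)) (table-val t 0 t<k (≤-trans z<s d<w))

    idleState-pos : ∀ {t} → 0 < t → idleState β t ≡ β
    idleState-pos {suc _} _ = refl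

    before-test : ∀ t → t < ts → Step₂' X t ≡ just (idleState β t)
    before-test zero    _      = refl
    before-test (suc t) 1+t<ts = trans (idle-step (<-trans t<ts ts<k) (before-test t t<ts))
                                       (cong just (testTable-idle {x = 0} (<⇒≢ t<ts) (<⇒≢ 1+t<ts)))
      where
      t<ts : t < ts
      t<ts = <-trans (n<1+n t) 1+t<ts

    at-test : Step₂' X ts ≡ just is
    at-test = subst (λ s → Step₂' X s ≡ just is) 1+[ts∸1]≡ts (entering (ts ∸ 1) 1+[ts∸1]≡ts)
      where
      1+[ts∸1]≡ts : suc (ts ∸ 1) ≡ ts
      1+[ts∸1]≡ts = m+[n∸m]≡n 0<ts
      entering : ∀ t → suc t ≡ ts → Step₂' X (suc t) ≡ just is
      entering t 1+t≡ts = trans (idle-step (<-trans t<ts ts<k) (before-test t t<ts)) (cong just (testTable-enter {x = 0} 1+t≡ts))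
        where
        t<ts : t < ts
        t<ts = ≤-reflexive 1+t≡ts

    after-test : Step₂' X (suc ts) ≡ just (testTable β ts is vs ts d)
    after-test = trans (Step₂′-suc at-test test-val) (table-val ts d ts<k d<w)

    accept : d ≡ vs → Step₂' X k ≡ just β
    accept refl = induction-from (λ t → Step₂' X t ≡ just β) (trans after-test (cong just testTable-hit)) stay ts<k ≤-refl
      where
      stay : ∀ {t} → suc ts ≤ t → t < k → Step₂' X t ≡ just β → Step₂' X (suc t) ≡ just β
      stay {t} ts<t t<k Sₜ≡β = trans (idle-step t<k (trans Sₜ≡β (cong just (sym (idleState-pos (≤-trans z<s ts<t))))))
                                     (cong just (testTable-idle {x = 0} (>⇒≢ ts<t) (>⇒≢ (m<n⇒m<1+n ts<t))))

    reject : d ≢ vs → NonPositive (Step₂' X k)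
    reject d≢vs = induction-from (λ t → NonPositive (Step₂' X t)) missed stuck ts<k ≤-refl
      where
      missed : NonPositive (Step₂' X (suc ts))
      missed = subst NonPositive (sym (trans after-test (cong just (testTable-miss d≢vs)))) zero
      dies : ∀ {t m} → 0 < t → t < k → Step₂' X t ≡ m → NonPositive m → Step₂' X (suc t) ≡ nothing
      dies {t} _ _ Sₜ≡ minus-one = Step₂′-dead {t} Sₜ≡
      dies {t} 0<t t<k Sₜ≡ zero = Step₂′-stuck {t} Sₜ≡ (dead-val t 0<t t<k)
      stuck : ∀ {t} → suc ts ≤ t → t < k → NonPositive (Step₂' X t) → NonPositive (Step₂' X (suc t))
      stuck {t} ts<t t<k Sₜ≤0 = subst NonPositive (sym (dies {t} (≤-trans z<s ts<t) t<k refl Sₜ≤0)) minus-one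

    output : Step₂ X (k ∸ 1) ≡ Step₂' X k
    output = cong (Step₂' X) (m+[n∸m]≡n (≤-trans z<s ts<k))

  walk-accept : d ≡ vs → 0 < β → SAF n k w X ≡ true
  walk-accept d≡vs = SAF-positive (trans output (accept d≡vs))

  walk-reject : d ≢ vs → SAF n k w X ≡ false
  walk-reject d≢vs = SAF-nonPositive (subst NonPositive (sym output) (reject d≢vs))

-- The hard inputs

module Construction (k₀ w₀ : ℕ) where

  k w : ℕ
  k = 2 + k₀
  w = 3 + w₀

  β : ℕ
  β = 2 + w₀

  digitBlocks lightBlocks roleBlocks : ℕ
  digitBlocks = (1 + k₀) * (1 + w₀)
  lightBlocks = k * w + (1 + k₀)
  roleBlocks  = digitBlocks + lightBlocks

  open Digits w

  -- holds e stores digit e of the number, cell t x is entry x of the table at time t,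
  -- and bypass j lets the run pass time 1 + j in state β.
  data Role : Set where
    idle   : Role
    holds  : ℕ → Role
    cell   : ℕ → ℕ → Role
    bypass : ℕ → Role

  data ValidRole : Role → Set where
    idle   : ValidRole idle
    holds  : ∀ {e} → e < digitBlocks → ValidRole (holds e)
    cell   : ∀ {t x} → t < k → x < w → ValidRole (cell t x)
    bypass : ∀ {j} → j < 1 + k₀ → ValidRole (bypass j)

  roleK : Role → ℕ
  roleK idle       = 0
  roleK (holds e)  = suc (e / (1 + w₀))
  roleK (cell t x) = t
  roleK (bypass j) = suc j

  roleW : Role → ℕ
  roleW idle       = 0
  roleW (holds e)  = suc (e % (1 + w₀))
  roleW (cell t x) = w + x
  roleW (bypass j) = β

  roleK<k : ∀ {r} → ValidRole r → roleK r < k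
  roleK<k idle          = z<s
  roleK<k (holds e<)    = s<s (m<n*o⇒m/o<n e<)
  roleK<k (cell t<k _)  = t<k
  roleK<k (bypass j<)   = s<s j<

  roleW<2w : ∀ {r} → ValidRole r → roleW r < 2 * w
  roleW<2w idle         = z<s
  roleW<2w (holds {e} _) = ≤-trans (s<s (m%n<n e (1 + w₀))) (≤-trans (n≤1+n β) (m≤m+n w (w + 0)))
  roleW<2w (cell {x = x} _ x<w) = subst (w + x <_) (cong (w +_) (sym (+-identityʳ w))) (+-monoʳ-< w x<w)
  roleW<2w (bypass _)   = m≤m+n w (w + 0)

  private
    roleW-holds<β : ∀ e → roleW (holds e) < β
    roleW-holds<β e = s<s (m%n<n e (1 + w₀))

    holds≢cell : ∀ e t x → roleW (holds e) ≢ roleW (cell t x)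
    holds≢cell e t x eq = <⇒≱ (roleW-holds<β e) (≤-trans (n≤1+n β) (≤-trans (m≤m+n w x) (≤-reflexive (sym eq))))

    holds≢bypass : ∀ e j → roleW (holds e) ≢ roleW (bypass j)
    holds≢bypass e j eq = <⇒≢ (roleW-holds<β e) eq

    cell≢bypass : ∀ t x j → roleW (cell t x) ≢ roleW (bypass j)
    cell≢bypass t x j eq = <⇒≱ (n<1+n β) (≤-trans (m≤m+n w x) (≤-reflexive eq))

  roleW≡0⇒idle : ∀ r → roleW r ≡ 0 → r ≡ idle
  roleW≡0⇒idle idle _ = refl

  role-address-injective : ∀ r r′ → roleK r ≡ roleK r′ → roleW r ≡ roleW r′ → r ≡ r′
  role-address-injective idle        idle          _   _   = refl
  role-address-injective (holds e)   (holds e′)    K≡  W≡  = cong holds (begin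
    e                                ≡⟨ m≡m%n+[m/n]*n e (1 + w₀) ⟩
    e % (1 + w₀) + e / (1 + w₀) * (1 + w₀)   ≡⟨ cong₂ (λ r q → r + q * (1 + w₀)) (suc-injective W≡) (suc-injective K≡) ⟩
    e′ % (1 + w₀) + e′ / (1 + w₀) * (1 + w₀) ≡⟨ m≡m%n+[m/n]*n e′ (1 + w₀) ⟨
    e′ ∎)
    where open ≡-Reasoning
  role-address-injective (cell t x)  (cell t′ x′)  K≡  W≡  = cong₂ cell K≡ (+-cancelˡ-≡ w x x′ W≡)
  role-address-injective (bypass j)  (bypass j′)   K≡  _   = cong bypass (suc-injective K≡)
  role-address-injective (holds e)   (cell t x)    _   W≡  = ⊥-elim (holds≢cell e t x W≡)
  role-address-injective (cell t x)  (holds e)     _   W≡  = ⊥-elim (holds≢cell e t x (sym W≡))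
  role-address-injective (holds e)   (bypass j)    _   W≡  = ⊥-elim (holds≢bypass e j W≡)
  role-address-injective (bypass j)  (holds e)     _   W≡  = ⊥-elim (holds≢bypass e j (sym W≡))
  role-address-injective (cell t x)  (bypass j)    _   W≡  = ⊥-elim (cell≢bypass t x j W≡)
  role-address-injective (bypass j)  (cell t x)    _   W≡  = ⊥-elim (cell≢bypass t x j (sym W≡))
  role-address-injective idle        (holds _)     ()  _
  role-address-injective idle        (cell _ _)    _   ()
  role-address-injective idle        (bypass _)    ()  _
  role-address-injective (holds _)   idle          ()  _
  role-address-injective (cell _ _)  idle          _   ()
  role-address-injective (bypass _)  idle          ()  _

  lightRole : ℕ → Role
  lightRole e = if e <ᵇ k * w then cell (e / w) (e % w) else bypass (e ∸ k * w)

  lightRole-valid : ∀ {e} → e < lightBlocks → ValidRole (lightRole e)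
  lightRole-valid {e} e< with e <ᵇ k * w | <ᵇ-reflects-< e (k * w)
  ... | true  | ofʸ e<kw = cell (m<n*o⇒m/o<n e<kw) (m%n<n e w)
  ... | false | ofⁿ e≮kw = bypass (+-cancelˡ-< (k * w) _ _ (subst (_< lightBlocks) (sym (m+[n∸m]≡n (≮⇒≥ e≮kw))) e<))

  cell-index< : ∀ {t x} → t < k → x < w → t * w + x < k * w
  cell-index< {t} {x} t<k x<w = ≤-trans (+-monoʳ-< (t * w) x<w) (≤-trans (≤-reflexive (+-comm (t * w) w)) (*-monoˡ-≤ w t<k))

  lightRole-cell : ∀ {t x} → t < k → x < w → lightRole (t * w + x) ≡ cell t x
  lightRole-cell {t} {x} t<k x<w with t * w + x <ᵇ k * w | <ᵇ-reflects-< (t * w + x) (k * w)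
  ... | true  | _        = cong₂ cell ([p*a+o]/a≡p w t x<w) ([p*a+o]%a≡o w t x<w)
  ... | false | ofⁿ ≮kw = ⊥-elim (≮kw (cell-index< t<k x<w))

  lightRole-bypass : ∀ j → lightRole (k * w + j) ≡ bypass j
  lightRole-bypass j with k * w + j <ᵇ k * w | <ᵇ-reflects-< (k * w + j) (k * w)
  ... | false | _       = cong bypass (m+n∸m≡n (k * w) j)
  ... | true  | ofʸ <kw = ⊥-elim (m+n≮m (k * w) j <kw)

  -- Block values for the number c and the test whether digit e of c equals v.
  value : (c e v : ℕ) → Role → ℕ
  value c e v idle       = 0
  value c e v (holds e′) = digit c e′
  value c e v (cell t x) = testTable β (roleK (holds e)) (roleW (holds e)) v t x
  value c e v (bypass j) = 0

  value<w : ∀ c e v r → value c e v r < w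
  value<w c e v idle       = z<s
  value<w c e v (holds e′) = digit<base c e′
  value<w c e v (cell t x) = testTable-< t x (n<1+n β) (m<n⇒m<1+n (roleW-holds<β e))
  value<w c e v (bypass j) = z<s

  value-lightRole : ∀ c c′ e v e′ → value c e v (lightRole e′) ≡ value c′ e v (lightRole e′)
  value-lightRole c c′ e v e′ with e′ <ᵇ k * w
  ... | true  = refl
  ... | false = refl

  module Layout (n : ℕ) (hn : 2 * k * w * (2 * w + ⌈log₂ k ⌉ + ⌈log₂ (2 * w) ⌉) < n) where

    open SAFDef n k w

    L : ℕ
    L = LK + LW

    L+2w<a : L + 2 * w < a
    L+2w<a = subst (_< a) (trans (+-assoc (2 * w) LK LW) (+-comm (2 * w) L)) (<-ceilDiv hn)

    instance
      a-nonZero : NonZero a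
      a-nonZero = >-nonZero (≤-trans z<s L+2w<a)

    L+b≡a : L + b ≡ a
    L+b≡a = m+[n∸m]≡n (≤-trans (m≤m+n L (2 * w)) (<⇒≤ L+2w<a))

    2w<b : 2 * w < b
    2w<b = +-cancelˡ-< L _ _ (subst (L + 2 * w <_) (sym L+b≡a) L+2w<a)

    L+j<a : ∀ {j} → j < b → L + j < a
    L+j<a {j} j<b = subst (L + j <_) L+b≡a (+-monoʳ-< L j<b)

    spareBlocks : ℕ
    spareBlocks = 4 + k₀ + w₀

    roleBlocks+spareBlocks≡nBlocks : roleBlocks + spareBlocks ≡ nBlocks
    roleBlocks+spareBlocks≡nBlocks = count-blocks k₀ w₀
      where
      count-blocks : ∀ k₀ w₀ → (1 + k₀) * (1 + w₀) + ((2 + k₀) * (3 + w₀) + (1 + k₀)) + (4 + k₀ + w₀) ≡ 2 * (2 + k₀) * (3 + w₀)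
      count-blocks = solve-∀

    roleBlocks≤spareBlocks*2w : roleBlocks ≤ spareBlocks * (2 * w)
    roleBlocks≤spareBlocks*2w = ≤-trans (m≤m+n roleBlocks (16 + k₀ + 11 * w₀ + 2 * w₀ * w₀)) (≤-reflexive (slack k₀ w₀))
      where
      slack : ∀ k₀ w₀ → (1 + k₀) * (1 + w₀) + ((2 + k₀) * (3 + w₀) + (1 + k₀)) + (16 + k₀ + 11 * w₀ + 2 * w₀ * w₀)
                        ≡ (4 + k₀ + w₀) * (2 * (3 + w₀))
      slack = solve-∀

    roleBlocks<nBlocks : roleBlocks < nBlocks
    roleBlocks<nBlocks = subst (roleBlocks <_) roleBlocks+spareBlocks≡nBlocks (m<m+n roleBlocks z<s)

    roleBlocks*a≤n : roleBlocks * a ≤ n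
    roleBlocks*a≤n = *ceilDiv≤ {n} {nBlocks} {roleBlocks} {spareBlocks} {2 * w} roleBlocks+spareBlocks≡nBlocks roleBlocks≤spareBlocks*2w
      (≤-trans (*-monoʳ-≤ nBlocks (≤-trans (m≤m+n (2 * w) LK) (m≤m+n _ LW))) (<⇒≤ hn))

    var : ℕ → ℕ → ℕ
    var p j = p * a + (L + j)

    var<n : ∀ {p j} → p < roleBlocks → j < b → var p j < n
    var<n {p} {j} p<R j<b = begin-strict
      p * a + (L + j)  <⟨ +-monoʳ-< (p * a) (L+j<a j<b) ⟩
      p * a + a        ≡⟨ +-comm (p * a) a ⟩
      suc p * a        ≤⟨ *-monoˡ-≤ a p<R ⟩
      roleBlocks * a   ≤⟨ roleBlocks*a≤n ⟩
      n ∎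
      where open ≤-Reasoning

    var/a≡p : ∀ p {j} → j < b → var p j / a ≡ p
    var/a≡p p j<b = [p*a+o]/a≡p a p (L+j<a j<b)

    var∸block≡j : ∀ p j → var p j ∸ (p * a + L) ≡ j
    var∸block≡j p j = trans (cong (_∸ (p * a + L)) (sym (+-assoc (p * a) L j))) (m+n∸m≡n (p * a + L) j)

    module Cut (θ : Permutation′ n) where

      open Positions θ

      inPrefix : ℕ → ℕ → Bool
      inPrefix u q = position q <ᵇ u

      prefixCount : ℕ → ℕ → ℕ
      prefixCount u p = count (λ j → inPrefix u (var p j)) b

      -- enough value variables in the prefix to write any base-w digit
      heavy : ℕ → ℕ → Bool
      heavy u p = β ≤ᵇ prefixCount u p

      heavyCount : ℕ → ℕ
      heavyCount u = count (heavy u) roleBlocks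

      private
        <ᵇ-suc : ∀ {x u} → x ≢ u → (x <ᵇ suc u) ≡ (x <ᵇ u)
        <ᵇ-suc {x} {u} x≢u with x <ᵇ u | <ᵇ-reflects-< x u
        ... | true  | ofʸ x<u = <⇒<ᵇ≡true (m<n⇒m<1+n x<u)
        ... | false | ofⁿ x≮u = ≮⇒<ᵇ≡false (λ x<1+u → x≮u (≤∧≢⇒< (≤-pred x<1+u) x≢u))

        variableAt≡var : ∀ {p j u} → p < roleBlocks → j < b → position (var p j) ≡ u → variableAt u ≡ var p j
        variableAt≡var p<R j<b refl = variableAt-position (var<n p<R j<b)

      prefixCount-suc : ∀ u {p} → p < roleBlocks → prefixCount (suc u) p ≤ suc (prefixCount u p)
      prefixCount-suc u {p} p<R = count-pointwise-update b (variableAt u ∸ (p * a + L)) (λ j j<b j≢ →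
        <ᵇ-suc (λ at-u → j≢ (trans (sym (var∸block≡j p j)) (cong (_∸ (p * a + L)) (sym (variableAt≡var p<R j<b at-u))))))

      heavy-suc : ∀ u {p} → p < roleBlocks → p ≢ variableAt u / a → heavy (suc u) p ≡ heavy u p
      heavy-suc u {p} p<R p≢ = cong (β ≤ᵇ_) (count-cong b (λ j j<b →
        <ᵇ-suc (λ at-u → p≢ (trans (sym (var/a≡p p j<b)) (cong (_/ a) (sym (variableAt≡var p<R j<b at-u)))))))

      heavyCount-suc : ∀ u → heavyCount (suc u) ≤ suc (heavyCount u)
      heavyCount-suc u = count-pointwise-update roleBlocks (variableAt u / a) (λ p p<R → heavy-suc u p<R)

      heavyCount-1 : heavyCount 1 ≡ 0
      heavyCount-1 = count-none roleBlocks (λ p p<R → ≰⇒≤ᵇ≡false (λ β≤ →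
        <⇒≱ (s≤s (s≤s z≤n)) (≤-trans β≤ (≤-trans (prefixCount-suc 0 p<R) (s≤s (≤-reflexive (prefixCount-0 p)))))))
        where
        prefixCount-0 : ∀ p → prefixCount 0 p ≡ 0
        prefixCount-0 p = count-none b (λ _ _ → refl)

      heavyCount-n : heavyCount n ≡ roleBlocks
      heavyCount-n = count-all roleBlocks (λ p p<R → ≤⇒≤ᵇ≡true (begin
        β        ≤⟨ ≤-trans (n≤1+n β) (≤-trans (m≤m+n w (w + 0)) (<⇒≤ 2w<b)) ⟩
        b        ≡⟨ count-all b (λ j j<b → <⇒<ᵇ≡true (position< (var<n p<R j<b))) ⟨
        prefixCount n p ∎))
        where open ≤-Reasoning

      balanced-cut : ∃ λ u → 1 < u × u < n × heavyCount u ≡ digitBlocks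
      balanced-cut = below-n (intermediate-value heavyCount heavyCount-suc 1≤n heavyCount1<digitBlocks digitBlocks≤heavyCountn)
        where
        1≤n : 1 ≤ n
        1≤n = ≤-trans (s≤s z≤n) hn
        heavyCount1<digitBlocks : heavyCount 1 < digitBlocks
        heavyCount1<digitBlocks = subst (_< digitBlocks) (sym heavyCount-1) z<s
        digitBlocks≤heavyCountn : digitBlocks ≤ heavyCount n
        digitBlocks≤heavyCountn = subst (digitBlocks ≤_) (sym heavyCount-n) (m≤m+n digitBlocks lightBlocks)
        below-n : (∃ λ u → 1 < u × u ≤ n × heavyCount u ≡ digitBlocks) → ∃ λ u → 1 < u × u < n × heavyCount u ≡ digitBlocks
        below-n (u , 1<u , u≤n , balanced) = u , 1<u , ≤∧≢⇒< u≤n u≢n , balanced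
          where
          u≢n : u ≢ n
          u≢n refl = <⇒≢ (m<m+n digitBlocks z<s) (trans (sym balanced) heavyCount-n)

      module Design (u : ℕ) (balanced : heavyCount u ≡ digitBlocks) where

        light : ℕ → Bool
        light p = not (heavy u p)

        lightCount : count light roleBlocks ≡ lightBlocks
        lightCount = +-cancelˡ-≡ digitBlocks _ _
          (trans (cong (_+ count light roleBlocks) (sym balanced)) (count-+-count-not (heavy u) roleBlocks))

        roleByWeight : ℕ → Role
        roleByWeight p = if heavy u p then holds (count (heavy u) p) else lightRole (count light p)

        role : ℕ → Role
        role p = if p <ᵇ roleBlocks then roleByWeight p else idle

        role-inside : ∀ {p} → p < roleBlocks → role p ≡ roleByWeight p
        role-inside {p} p<R = cong (λ inside → if inside then roleByWeight p else idle) (<⇒<ᵇ≡true p<R)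

        role-heavy : ∀ {p} → p < roleBlocks → heavy u p ≡ true → role p ≡ holds (count (heavy u) p)
        role-heavy {p} p<R h = trans (role-inside p<R) (cong (λ h → if h then holds (count (heavy u) p) else lightRole (count light p)) h)

        role-light : ∀ {p} → p < roleBlocks → heavy u p ≡ false → role p ≡ lightRole (count light p)
        role-light {p} p<R h = trans (role-inside p<R) (cong (λ h → if h then holds (count (heavy u) p) else lightRole (count light p)) h)

        role-outside : ∀ {p} → roleBlocks ≤ p → role p ≡ idle
        role-outside {p} R≤p = cong (λ inside → if inside then roleByWeight p else idle) (≮⇒<ᵇ≡false (≤⇒≯ R≤p))

        role-valid : ∀ p → ValidRole (role p)
        role-valid p with p <? roleBlocks
        ... | no  p≮R = subst ValidRole (sym (role-outside (≮⇒≥ p≮R))) idle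
        ... | yes p<R = by-weight (heavy u p) refl
          where
          by-weight : ∀ h → heavy u p ≡ h → ValidRole (role p)
          by-weight true  h = subst ValidRole (sym (role-heavy p<R h))
            (holds (subst (count (heavy u) p <_) balanced (rank<count (heavy u) h p<R)))
          by-weight false h = subst ValidRole (sym (role-light p<R h))
            (lightRole-valid (subst (count light p <_) lightCount (rank<count light (cong not h) p<R)))

        holds-realized : ∀ {e} → e < digitBlocks → ∃ λ p → p < roleBlocks × role p ≡ holds e
        holds-realized {e} e< with rank-surjective (heavy u) roleBlocks (subst (e <_) (sym balanced) e<)
        ... | p , p<R , h , rank≡e = p , p<R , trans (role-heavy p<R h) (cong holds rank≡e)

        light-realized : ∀ {e} → e < lightBlocks → ∃ λ p → p < roleBlocks × role p ≡ lightRole e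
        light-realized {e} e< with rank-surjective light roleBlocks (subst (e <_) (sym lightCount) e<)
        ... | p , p<R , l , rank≡e = p , p<R , trans (role-light p<R (Bool.not-injective l)) (cong lightRole rank≡e)

        onHeavySide : ℕ → Bool → Bool
        onHeavySide p side = if heavy u p then side else not side

        heavySide : ℕ → ℕ → Bool
        heavySide p j = onHeavySide p (inPrefix u (var p j))

        β≤heavySideCount : ∀ {p} → p < roleBlocks → β ≤ count (heavySide p) b
        β≤heavySideCount {p} p<R = by-weight (heavy u p) refl
          where
          open ≤-Reasoning
          prefix-side : ℕ → Bool
          prefix-side j = inPrefix u (var p j)
          on-side : ∀ {h} → heavy u p ≡ h → ∀ j → j < b → heavySide p j ≡ (if h then prefix-side j else not (prefix-side j))
          on-side h≡ j _ = cong (λ h → if h then prefix-side j else not (prefix-side j)) h≡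
          by-weight : ∀ h → heavy u p ≡ h → β ≤ count (heavySide p) b
          by-weight true  h = begin
            β                        ≤⟨ ≤ᵇ≡true⇒≤ h ⟩
            count prefix-side b      ≡⟨ count-cong b (on-side h) ⟨
            count (heavySide p) b    ∎
          by-weight false h = +-cancelˡ-≤ (count prefix-side b) _ _ (begin
            count prefix-side b + β  ≤⟨ +-monoˡ-≤ β (<⇒≤ (≤ᵇ≡false⇒> h)) ⟩
            β + β                    ≤⟨ +-mono-≤ (n≤1+n β) (≤-trans (n≤1+n β) (m≤m+n w 0)) ⟩
            2 * w                    ≤⟨ <⇒≤ 2w<b ⟩
            b                        ≡⟨ count-+-count-not prefix-side b ⟨
            count prefix-side b + count (λ j → not (prefix-side j)) b ≡⟨ cong (count prefix-side b +_) (count-cong b (on-side h)) ⟨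
            count prefix-side b + count (heavySide p) b ∎)

        value≤heavySideCount : ∀ c e v p → value c e v (role p) ≤ count (heavySide p) b
        value≤heavySideCount c e v p with p <? roleBlocks
        ... | no  p≮R = subst (λ r → value c e v r ≤ count (heavySide p) b) (sym (role-outside (≮⇒≥ p≮R))) z≤n
        ... | yes p<R = ≤-trans (≤-pred (value<w c e v (role p))) (β≤heavySideCount p<R)

        blockBit : (c e v : ℕ) → Bool → ℕ → ℕ → Bool
        blockBit c e v side p o =
          if o <ᵇ LK then bit (roleK (role p)) o
          else if o <ᵇ L then bit (roleW (role p)) (o ∸ LK)
          else onHeavySide p side ∧ (count (heavySide p) (o ∸ L) <ᵇ value c e v (role p))

        hardBit : (c e v : ℕ) → ℕ → Bool
        hardBit c e v q = blockBit c e v (inPrefix u q) (q / a) (q % a)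

        blockBit-cong : ∀ {c e v c′ e′ v′} side p o →
          (onHeavySide p side ≡ true → value c e v (role p) ≡ value c′ e′ v′ (role p)) →
          blockBit c e v side p o ≡ blockBit c′ e′ v′ side p o
        blockBit-cong {c} {e} {v} {c′} {e′} {v′} side p o same =
          cong (λ valueBit → if o <ᵇ LK then bit (roleK (role p)) o else if o <ᵇ L then bit (roleW (role p)) (o ∸ LK) else valueBit)
               (∧-cong (onHeavySide p side) same)
          where
          ∧-cong : ∀ x → (x ≡ true → value c e v (role p) ≡ value c′ e′ v′ (role p)) →
            x ∧ (count (heavySide p) (o ∸ L) <ᵇ value c e v (role p)) ≡ x ∧ (count (heavySide p) (o ∸ L) <ᵇ value c′ e′ v′ (role p))
          ∧-cong true  same = cong (count (heavySide p) (o ∸ L) <ᵇ_) (same refl)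
          ∧-cong false _    = refl

        blockBit-idle : ∀ {c e v side p} o → role p ≡ idle → blockBit c e v side p o ≡ false
        blockBit-idle {c} {e} {v} {side} {p} o r≡idle = begin
          blockBit c e v side p o
            ≡⟨ cong (λ r → if o <ᵇ LK then bit (roleK r) o else if o <ᵇ L then bit (roleW r) (o ∸ LK)
                           else onHeavySide p side ∧ (count (heavySide p) (o ∸ L) <ᵇ value c e v r)) r≡idle ⟩
          (if o <ᵇ LK then bit 0 o else if o <ᵇ L then bit 0 (o ∸ LK) else onHeavySide p side ∧ false)
            ≡⟨ cong₂ (λ x y → if o <ᵇ LK then x else if o <ᵇ L then y else onHeavySide p side ∧ false) (bit-zero o) (bit-zero (o ∸ LK)) ⟩
          (if o <ᵇ LK then false else if o <ᵇ L then false else onHeavySide p side ∧ false)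
            ≡⟨ cong (λ x → if o <ᵇ LK then false else if o <ᵇ L then false else x) (Bool.∧-zeroʳ (onHeavySide p side)) ⟩
          (if o <ᵇ LK then false else if o <ᵇ L then false else false)
            ≡⟨ trans (cong (if o <ᵇ LK then false else_) (Bool.if-eta (o <ᵇ L))) (Bool.if-eta (o <ᵇ LK)) ⟩
          false ∎
          where open ≡-Reasoning

        private
          heavy-if-prefix : ∀ p → onHeavySide p true ≡ true → heavy u p ≡ true
          heavy-if-prefix p = by-weight (heavy u p) refl
            where
            by-weight : ∀ h → heavy u p ≡ h → onHeavySide p true ≡ true → heavy u p ≡ true
            by-weight true  h _ = h
            by-weight false h on with () ← trans (sym (cong (λ h → if h then true else false) h)) on

          light-if-suffix : ∀ p → onHeavySide p false ≡ true → heavy u p ≡ false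
          light-if-suffix p = by-weight (heavy u p) refl
            where
            by-weight : ∀ h → heavy u p ≡ h → onHeavySide p false ≡ true → heavy u p ≡ false
            by-weight false h _  = h
            by-weight true  h on with () ← trans (sym (cong (λ h → if h then false else true) h)) on

        hardBit-prefix : ∀ c e v e′ v′ {q} → inPrefix u q ≡ true → hardBit c e v q ≡ hardBit c e′ v′ q
        hardBit-prefix c e v e′ v′ {q} pre = blockBit-cong (inPrefix u q) p (q % a) λ on →
          values (p <? roleBlocks) (heavy-if-prefix p (subst (λ s → onHeavySide p s ≡ true) pre on))
          where
          p : ℕ
          p = q / a
          values : Dec (p < roleBlocks) → heavy u p ≡ true → value c e v (role p) ≡ value c e′ v′ (role p)
          values (yes p<R) h = trans (cong (value c e v) (role-heavy p<R h)) (cong (value c e′ v′) (sym (role-heavy p<R h)))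
          values (no  p≮R) _ = trans (cong (value c e v) (role-outside (≮⇒≥ p≮R))) (cong (value c e′ v′) (sym (role-outside (≮⇒≥ p≮R))))

        hardBit-suffix : ∀ c c′ e v {q} → inPrefix u q ≡ false → hardBit c e v q ≡ hardBit c′ e v q
        hardBit-suffix c c′ e v {q} suf = blockBit-cong (inPrefix u q) p (q % a) λ on →
          values (p <? roleBlocks) (light-if-suffix p (subst (λ s → onHeavySide p s ≡ true) suf on))
          where
          p : ℕ
          p = q / a
          values : Dec (p < roleBlocks) → heavy u p ≡ false → value c e v (role p) ≡ value c′ e v (role p)
          values (yes p<R) l = trans (cong (value c e v) (role-light p<R l))
                                     (trans (value-lightRole c c′ e v (count light p)) (cong (value c′ e v) (sym (role-light p<R l))))
          values (no  p≮R) _ = trans (cong (value c e v) (role-outside (≮⇒≥ p≮R))) (cong (value c′ e v) (sym (role-outside (≮⇒≥ p≮R))))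

        hardBit-outside : ∀ c e v {q} → n ≤ q → hardBit c e v q ≡ false
        hardBit-outside c e v {q} n≤q = blockBit-idle {c} {e} {v} {inPrefix u q} {q / a} (q % a) (role-outside (begin
          roleBlocks              ≡⟨ m*n/n≡m roleBlocks a ⟨
          roleBlocks * a / a      ≤⟨ /-monoˡ-≤ a (≤-trans roleBlocks*a≤n n≤q) ⟩
          q / a                   ∎))
          where open ≤-Reasoning

        module Reading (c e v : ℕ) (X : Fin n → Bool) (X≗hardBit : ∀ q → bitAt X q ≡ hardBit c e v q) where

          open SAFProperties {n} {k} {w} X

          private
            L<a : L < a
            L<a = ≤-trans (s≤s (m≤m+n L (2 * w))) L+2w<a

            bitAt-block : ∀ p {o} → o < a → bitAt X (p * a + o) ≡ blockBit c e v (inPrefix u (p * a + o)) p o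
            bitAt-block p {o} o<a = trans (X≗hardBit (p * a + o))
              (cong₂ (blockBit c e v (inPrefix u (p * a + o))) ([p*a+o]/a≡p a p o<a) ([p*a+o]%a≡o a p o<a))

            addressK-bit : ∀ p {j} → j < LK → y X p j ≡ bit (roleK (role p)) j
            addressK-bit p j<LK = trans (bitAt-block p (<-≤-trans j<LK (≤-trans (m≤m+n LK LW) (<⇒≤ L<a))))
                                        (if-true (<⇒<ᵇ≡true j<LK))

            addressW-bit : ∀ p {j} → j < LW → y X p (j + LK) ≡ bit (roleW (role p)) j
            addressW-bit p {j} j<LW = begin
              bitAt X (p * a + (j + LK))  ≡⟨ bitAt-block p (<-trans j+LK<L L<a) ⟩
              blockBit c e v _ p (j + LK) ≡⟨ if-false (≮⇒<ᵇ≡false (≤⇒≯ (m≤n+m LK j))) ⟩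
              _                           ≡⟨ if-true (<⇒<ᵇ≡true j+LK<L) ⟩
              bit (roleW (role p)) (j + LK ∸ LK) ≡⟨ cong (bit (roleW (role p))) (m+n∸n≡m j LK) ⟩
              bit (roleW (role p)) j ∎
              where
              open ≡-Reasoning
              j+LK<L : j + LK < L
              j+LK<L = subst (j + LK <_) (+-comm LW LK) (+-monoˡ-< LK j<LW)

            value-bit : ∀ p {j} → j < b → x X p j ≡ heavySide p j ∧ (count (heavySide p) j <ᵇ value c e v (role p))
            value-bit p {j} j<b = begin
              bitAt X (var p j)          ≡⟨ bitAt-block p (L+j<a j<b) ⟩
              blockBit c e v _ p (L + j) ≡⟨ if-false (≮⇒<ᵇ≡false (≤⇒≯ (≤-trans (m≤m+n LK LW) (m≤m+n L j)))) ⟩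
              _                          ≡⟨ if-false (≮⇒<ᵇ≡false (≤⇒≯ (m≤m+n L j))) ⟩
              heavySide p j ∧ (count (heavySide p) (L + j ∸ L) <ᵇ value c e v (role p))
                                         ≡⟨ cong (λ i → heavySide p j ∧ (count (heavySide p) i <ᵇ value c e v (role p))) (m+n∸m≡n L j) ⟩
              heavySide p j ∧ (count (heavySide p) j <ᵇ value c e v (role p)) ∎
              where open ≡-Reasoning

          AdrK-role : ∀ p → AdrK X p ≡ roleK (role p)
          AdrK-role p = begin
            sumTo LK (λ j → bitVal (y X p j) * 2 ^ j) % k
              ≡⟨ cong (_% k) (sumTo-cong LK (λ j j<LK → cong (λ z → bitVal z * 2 ^ j) (addressK-bit p j<LK))) ⟩
            sumTo LK (λ j → bitVal (bit (roleK (role p)) j) * 2 ^ j) % k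
              ≡⟨ cong (_% k) (binary-expansion LK _ (<-≤-trans (roleK<k (role-valid p)) (n≤2^⌈log₂n⌉ k))) ⟩
            roleK (role p) % k
              ≡⟨ m<n⇒m%n≡m (roleK<k (role-valid p)) ⟩
            roleK (role p) ∎
            where open ≡-Reasoning

          AdrW-role : ∀ p → AdrW X p ≡ roleW (role p)
          AdrW-role p = begin
            sumTo LW (λ j → bitVal (y X p (j + LK)) * 2 ^ j) % (2 * w)
              ≡⟨ cong (_% (2 * w)) (sumTo-cong LW (λ j j<LW → cong (λ z → bitVal z * 2 ^ j) (addressW-bit p j<LW))) ⟩
            sumTo LW (λ j → bitVal (bit (roleW (role p)) j) * 2 ^ j) % (2 * w)
              ≡⟨ cong (_% (2 * w)) (binary-expansion LW _ (<-≤-trans (roleW<2w (role-valid p)) (n≤2^⌈log₂n⌉ (2 * w)))) ⟩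
            roleW (role p) % (2 * w)
              ≡⟨ m<n⇒m%n≡m (roleW<2w (role-valid p)) ⟩
            roleW (role p) ∎
            where open ≡-Reasoning

          blockValue-role : ∀ p → blockValue p ≡ value c e v (role p)
          blockValue-role p = begin
            sumTo b (λ j → bitVal (x X p j)) % w
              ≡⟨ cong (_% w) (sumTo-cong b (λ j j<b → cong bitVal (value-bit p j<b))) ⟩
            sumTo b (λ j → bitVal (heavySide p j ∧ (count (heavySide p) j <ᵇ value c e v (role p)))) % w
              ≡⟨ cong (_% w) (count-first (heavySide p) (value c e v (role p)) b) ⟩
            (value c e v (role p) ⊓ count (heavySide p) b) % w
              ≡⟨ cong (_% w) (m≤n⇒m⊓n≡m (value≤heavySideCount c e v p)) ⟩
            value c e v (role p) % w
              ≡⟨ m<n⇒m%n≡m (value<w c e v (role p)) ⟩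
            value c e v (role p) ∎
            where open ≡-Reasoning

          Val-role : ∀ {p₀} → p₀ < nBlocks → Val X (roleW (role p₀)) (roleK (role p₀)) ≡ just (value c e v (role p₀))
          Val-role {p₀} p₀<m = Val-present p₀<m (AdrK-role p₀) (AdrW-role p₀) λ p _ K≡ W≡ →
            trans (blockValue-role p) (cong (value c e v)
              (role-address-injective (role p) (role p₀) (trans (sym (AdrK-role p)) K≡) (trans (sym (AdrW-role p)) W≡)))

          Val-realized : ∀ {r} → (∃ λ p → p < roleBlocks × role p ≡ r) → Val X (roleW r) (roleK r) ≡ just (value c e v r)
          Val-realized (p , p<R , refl) = Val-role (<-trans p<R roleBlocks<nBlocks)

          Val-unused : ∀ t → 0 < t → t < k → Val X 0 t ≡ nothing
          Val-unused t 0<t _ = Val-absent λ p _ K≡t W≡0 →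
            <⇒≢ 0<t (sym (trans (sym K≡t) (trans (AdrK-role p) (cong roleK (roleW≡0⇒idle (role p) (trans (sym (AdrW-role p)) W≡0))))))

          Val-idle : ∀ t → t < k → Val X (idleState β t) t ≡ just 0
          Val-idle zero    _     = subst (λ r → Val X (roleW r) (roleK r) ≡ just (value c e v r)) (role-outside ≤-refl) (Val-role roleBlocks<nBlocks)
          Val-idle (suc j) 1+j<k = subst (λ r → Val X (roleW r) (roleK r) ≡ just (value c e v r)) (lightRole-bypass j)
            (Val-realized (light-realized (+-monoʳ-< (k * w) (≤-pred 1+j<k))))

          Val-table : ∀ t x → t < k → x < w → Val X (x + w) t ≡ just (testTable β (roleK (holds e)) (roleW (holds e)) v t x)
          Val-table t x t<k x<w = subst (λ i → Val X i t ≡ just (value c e v (cell t x))) (+-comm w x)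
            (subst (λ r → Val X (roleW r) (roleK r) ≡ just (value c e v r)) (lightRole-cell t<k x<w)
              (Val-realized (light-realized (<-≤-trans (cell-index< t<k x<w) (m≤m+n (k * w) (1 + k₀))))))

          SAF-accepts : e < digitBlocks → digit c e ≡ v → SAF n k w X ≡ true
          SAF-accepts e< d≡v = Walk.walk-accept X z<s (roleK<k (holds e<)) Val-idle Val-table
            (Val-realized (holds-realized e<)) (digit<base c e) Val-unused d≡v z<s

          SAF-rejects : e < digitBlocks → digit c e ≢ v → SAF n k w X ≡ false
          SAF-rejects e< d≢v = Walk.walk-reject X z<s (roleK<k (holds e<)) Val-idle Val-table
            (Val-realized (holds-realized e<)) (digit<base c e) Val-unused d≢v

        numberPart : ℕ → List Bool
        numberPart c = prefix (hardBit c 0 0) u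

        testPart : ℕ → ℕ → List Bool
        testPart e v = suffix (hardBit 0 e v) u

        input : (c e v : ℕ) → Fin n → Bool
        input c e v = reorder θ (numberPart c ++ testPart e v)

        input≗hardBit : ∀ c e v q → bitAt (input c e v) q ≡ hardBit c e v q
        input≗hardBit c e v = reorder-prefix++suffix u (hardBit c e v) (hardBit c 0 0) (hardBit 0 e v)
          (λ q _ in-prefix → hardBit-prefix c 0 0 e v (<⇒<ᵇ≡true in-prefix))
          (λ q _ in-suffix → hardBit-suffix 0 c e v (≮⇒<ᵇ≡false (≤⇒≯ in-suffix)))
          (λ q n≤q → hardBit-outside c e v n≤q)

        -- Two numbers differing in digit e are told apart by the test (e, digit of the first).
        subfunctions-distinct : Injective _≡_ _≡_ (λ (c : Fin (w ^ digitBlocks)) → subfun (SAF n k w) θ u (numberPart (toℕ c)))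
        subfunctions-distinct {c} {c′} same = by-cases (c Fin.≟ c′)
          where
          separate : (∃ λ e → e < digitBlocks × digit (toℕ c) e ≢ digit (toℕ c′) e) → ⊥
          separate (e , e< , differ) = true≢false (begin
            true                                  ≡⟨ Reading.SAF-accepts (toℕ c) e v _ (input≗hardBit (toℕ c) e v) e< refl ⟨
            SAF n k w (input (toℕ c) e v)         ≡⟨ subfun-≡⇒≡ (SAF n k w) θ {u} {numberPart (toℕ c)} {numberPart (toℕ c′)} (testPart e v) (length-applyUpTo _ (n ∸ u)) same ⟩
            SAF n k w (input (toℕ c′) e v)        ≡⟨ Reading.SAF-rejects (toℕ c′) e v _ (input≗hardBit (toℕ c′) e v) e< (differ ∘ sym) ⟩
            false                                 ∎)
            where
            open ≡-Reasoning
            v : ℕ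
            v = digit (toℕ c) e
            true≢false : true ≢ false
            true≢false ()
          by-cases : Dec (c ≡ c′) → c ≡ c′
          by-cases (yes c≡c′) = c≡c′
          by-cases (no  c≢c′) = ⊥-elim (separate (digits-distinguish digitBlocks (toℕ<n c) (toℕ<n c′) (c≢c′ ∘ toℕ-injective)))

        lower-bound : w ^ digitBlocks ≤ Npart (SAF n k w) θ u
        lower-bound = Npart-≥ (SAF n k w) θ u (λ c → numberPart (toℕ c)) (λ c → length-applyUpTo _ u) subfunctions-distinct

      Nperm-bound : w ^ digitBlocks ≤ Nperm (SAF n k w) θ
      Nperm-bound = at-cut balanced-cut
        where
        at-cut : (∃ λ u → 1 < u × u < n × heavyCount u ≡ digitBlocks) → w ^ digitBlocks ≤ Nperm (SAF n k w) θ
        at-cut (u , 1<u , u<n , balanced) = ≤-trans (Design.lower-bound u balanced) (Npart≤Nperm (SAF n k w) θ 1<u u<n)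

degenerate-bound : ∀ n k w → 1 ≤ k → 1 ≤ w →
  2 * k * w * (2 * w + ⌈log₂ k ⌉ + ⌈log₂ (2 * w) ⌉) < n →
  (θ : Permutation′ n) → (k ∸ 1) * (w ∸ 2) ≡ 0 →
  w ^ ((k ∸ 1) * (w ∸ 2)) ≤ Nperm (SAF n k w) θ
degenerate-bound n k w 1≤k 1≤w hn θ no-digits = subst (λ e → w ^ e ≤ Nperm (SAF n k w) θ) (sym no-digits)
  (1≤Nperm (SAF n k w) θ (≤-<-trans 2≤size hn))
  where
  open ≤-Reasoning
  0<blocks : 0 < 2 * k * w
  0<blocks = *-mono-≤ (*-mono-≤ (s≤s (z≤n {1})) 1≤k) 1≤w
  2≤size : 2 ≤ 2 * k * w * (2 * w + ⌈log₂ k ⌉ + ⌈log₂ (2 * w) ⌉)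
  2≤size = begin
    2                                         ≤⟨ *-monoʳ-≤ 2 1≤w ⟩
    2 * w                                     ≤⟨ ≤-trans (m≤m+n (2 * w) ⌈log₂ k ⌉) (m≤m+n _ ⌈log₂ (2 * w) ⌉) ⟩
    2 * w + ⌈log₂ k ⌉ + ⌈log₂ (2 * w) ⌉       ≤⟨ m≤n*m _ (2 * k * w) {{>-nonZero 0<blocks}} ⟩
    2 * k * w * (2 * w + ⌈log₂ k ⌉ + ⌈log₂ (2 * w) ⌉) ∎

lemma3 : (n k w : ℕ) → 1 ≤ k → 1 ≤ w →
         2 * k * w * (2 * w + ⌈log₂ k ⌉ + ⌈log₂ (2 * w) ⌉) < n →
         (θ : Permutation′ n) →
         w ^ ((k ∸ 1) * (w ∸ 2)) ≤ Nperm (SAF n k w) θ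
lemma3 n 1                  w                  1≤k 1≤w hn θ = degenerate-bound n 1 w 1≤k 1≤w hn θ refl
lemma3 n (suc (suc k₀))     1                  1≤k 1≤w hn θ = degenerate-bound n _ 1 1≤k 1≤w hn θ (*-zeroʳ (suc k₀))
lemma3 n (suc (suc k₀))     2                  1≤k 1≤w hn θ = degenerate-bound n _ 2 1≤k 1≤w hn θ (*-zeroʳ (suc k₀))
lemma3 n (suc (suc k₀)) (suc (suc (suc w₀))) _   _   hn θ = Construction.Layout.Cut.Nperm-bound k₀ w₀ n hn θ
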